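{- Under strict multiteam semantics, every formula of dependence logic $\mathrm{FO}(=\!(\cdot))$ is weakly flat: for every such formula $\varphi$, every multistructure $\mathfrak A$ and every multiteam $(X,m)$ over $\mathfrak A$, $\mathfrak A\models_{(X,m)}\varphi$ iff $\mathfrak A\models_{(X,n)}\varphi$, where $n(s)=0$ if $m(s)=0$ and $n(s)=1$ otherwise.
   Context: Multisets: a multiset is a pair $(A,m)$ with $m:A\to\mathbb N$ (multiplicity $0$ allowed); all multisets are finite. Canonical set representative: $\{(a,i):a\in A,0<i\le m(a)\}$; $(A,m)\subseteq(B,n)$ iff canonical representative of $(A,m)$ is a subset of that of $(B,n)$; equality of multisets means mutual inclusion; $(A,m)\uplus(B,n)=(A\cup B,k)$ with $k$ the sum of multiplicities (missing elements count as $0$). An assignment is a function $s:D\to A$, $D$ a finite set of variables; $s(a/x)$ sends $x$ to $a$ and agrees with $s$ elsewhere; $s(\vec x)=(s(x_1),\dots,s(x_k))$. A team is a finite set of assignments with common domain and codomain; a multiteam is a multiset $(X,m)$ with $X$ a team. A $\tau$-multistructure is $\mathfrak A=((A,n),(R^{\mathfrak A})_{R\in\tau})$, $(A,n)$ a finite multiset, $R^{\mathfrak A}$ an $\mathrm{ar}(R)$-ary relation on $\{a:n(a)\ge1\}$; multiteams over $\mathfrak A$ have codomain $A$. Modified multiteams: $(X,m)[(A,n)/x]:=\biguplus_{s\in X}\biguplus_{a\in A}\{(s(a/x),m(s)n(a))\}$; for a function $F$ from the canonical representative of $(X,m)$ to submultisets of $(A,n)$, $(X,m)[F/x]:=\biguplus_{s\in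 X}\biguplus_{1\le i\le m(s)}\{(s(b/x),l(b)):(B,l)=F((s,i)),b\in B\}$. Syntax: first-order formulas $x=y\mid x\ne y\mid R(\vec x)\mid\neg R(\vec x)\mid\varphi\wedge\varphi\mid\varphi\vee\varphi\mid\exists x\varphi\mid\forall x\varphi$, extended by the (unnegated) atoms $=\!(\vec x,\vec y)$. Strict multiteam semantics: first-order literals hold iff every $s\in X$ with $m(s)\ge1$ satisfies them classically; $\wedge$ classical; $\psi\vee\theta$ holds in $(X,m)$ iff $(Y,k)\models\psi$ and $(Z,l)\models\theta$ for some $(Y,k),(Z,l)\subseteq(X,m)$ with $(Y,k)\uplus(Z,l)=(X,m)$; $\forall x\psi$ iff $\psi$ holds in $(X,m)[(A,n)/x]$; $\exists x\psi$ iff $\psi$ holds in $(X,m)[F/x]$ for some $F$ such that for all $s\in X$ and $0<i\le m(s)$, $F((s,i))=(\{b\},l)$ for some $b\in A$ with $n(b)\ge1$ and $l(b)=1$. $=\!(\vec x,\vec y)$ holds iff all $s,s'\in X$ with $m(s),m(s')\ge1$ and $s(\vec x)=s'(\vec x)$ have $s(\vec y)=s'(\vec y)$. -}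

module Defs where

open import Level using (0ℓ)
open import Data.Nat using (ℕ; zero; suc; _+_; _*_; _≤_)
open import Data.Nat.Properties using () renaming (_≟_ to _≟ℕ_)
open import Data.Fin using (Fin)
open import Data.Fin.Properties using () renaming (_≟_ to _≟F_)
open import Data.Bool using (Bool; if_then_else_)
open import Data.Maybe using (Maybe; just; nothing; is-just)
import Data.Maybe.Properties as MaybeP
open import Data.List using (List; []; _∷_; map; concatMap; allFin)
open import Data.Nat.ListAction using (sum)
open import Data.Vec using (Vec; lookup; _[_]≔_) renaming (map to vmap; [] to v[]; _∷_ to _v∷_)
import Data.Vec.Properties as VecP
open import Data.Vec.Relation.Unary.All using (All)
open import Data.Product using (Σ; ∃; _×_; _,_)
open import Relation.Nullary using (¬_; does)
open import Relation.Binary.PropositionalEquality using (_≡_; _≢_)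
open import Function.Bundles using (_⇔_)

record Signature : Set₁ where
  field
    Sym : Set
    ar  : Sym → ℕ

open Signature public

-- A τ-multistructure: the carrier multiset (A , n) with A = Fin card,
-- n = mult (multiplicity 0 allowed); relations only contain tuples of
-- elements of multiplicity ≥ 1.
record MultiStructure (τ : Signature) : Set₁ where
  field
    card  : ℕ
    mult  : Fin card → ℕ
    rel   : (R : Sym τ) → Vec (Fin card) (ar τ R) → Set
    relOK : (R : Sym τ) (v : Vec (Fin card) (ar τ R)) →
            rel R v → All (λ a → 1 ≤ mult a) v

open MultiStructure public

data Formula (τ : Signature) (N : ℕ) : Set where
  _≐_ _≠_ : Fin N → Fin N → Formula τ N
  rel⁺ rel⁻ : (R : Sym τ) → Vec (Fin N) (ar τ R) → Formula τ N
  dep : List (Fin N) → List (Fin N) → Formula τ N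
  _∧_ _∨_ : Formula τ N → Formula τ N → Formula τ N
  ∃′ ∀′ : Fin N → Formula τ N → Formula τ N

-- An assignment with domain D ⊆ Fin N into A = Fin k:
-- position x holds (just a) if x ∈ D and s(x) = a, nothing if x ∉ D.
Asg : ℕ → ℕ → Set
Asg k N = Vec (Maybe (Fin k)) N

domain : ∀ {k N} → Asg k N → Vec Bool N
domain = vmap is-just

_≟A_ : ∀ {k N} (s t : Asg k N) → Relation.Nullary.Dec (s ≡ t)
_≟A_ = VecP.≡-dec (MaybeP.≡-dec _≟F_)

allAsg : ∀ k N → List (Asg k N)
allAsg k zero    = v[] ∷ []
allAsg k (suc N) =
  concatMap (λ o → map (o v∷_) (allAsg k N)) (nothing ∷ map just (allFin k))

-- A multiteam (X , m) is represented by its multiplicity function on all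
-- assignments (multiplicity 0 outside X).
MTeam : ℕ → ℕ → Set
MTeam k N = Asg k N → ℕ

IsMultiteam : ∀ {k N} → MTeam k N → Set
IsMultiteam {k} {N} m = Σ (Vec Bool N) λ D → (s : Asg k N) → m s ≢ 0 → domain s ≡ D

[_≡?_]·_ : ∀ {k N} → Asg k N → Asg k N → ℕ → ℕ
[ u ≡? t ]· c = if does (u ≟A t) then c else 0

forallMod : ∀ {τ N} (𝔄 : MultiStructure τ) → MTeam (card 𝔄) N → Fin N → MTeam (card 𝔄) N
forallMod 𝔄 m x t =
  sum (map (λ s → sum (map (λ a → [ s [ x ]≔ just a ≡? t ]· (m s * mult 𝔄 a))
                           (allFin (card 𝔄))))
           (allAsg (card 𝔄) _))

-- (X,m)[F/x] for F choosing one element (multiplicity 1) for each copy (s,i)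
existsMod : ∀ {k N} (m : MTeam k N) → Fin N →
            ((s : Asg k N) → Fin (m s) → Fin k) → MTeam k N
existsMod {k} {N} m x F t =
  sum (map (λ s → sum (map (λ i → [ s [ x ]≔ just (F s i) ≡? t ]· 1)
                           (allFin (m s))))
           (allAsg k N))

-- Classical satisfaction of literals by a single assignment
-- (a literal mentioning a variable outside the domain is not satisfied)

values : ∀ {k N n} → Asg k N → Vec (Fin N) n → Vec (Maybe (Fin k)) n
values s xs = vmap (lookup s) xs

module _ {τ : Signature} {N : ℕ} (𝔄 : MultiStructure τ) where

  private
    A = Fin (card 𝔄)

  litEq litNeq : Asg (card 𝔄) N → Fin N → Fin N → Set
  litEq  s x y = Σ A λ a → (lookup s x ≡ just a) × (lookup s y ≡ just a)
  litNeq s x y = Σ A λ a → Σ A λ b →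
                 (lookup s x ≡ just a) × (lookup s y ≡ just b) × (a ≢ b)

  litRel litNRel : Asg (card 𝔄) N → (R : Sym τ) → Vec (Fin N) (ar τ R) → Set
  litRel  s R xs = Σ (Vec A (ar τ R)) λ v → (values s xs ≡ vmap just v) × rel 𝔄 R v
  litNRel s R xs = Σ (Vec A (ar τ R)) λ v → (values s xs ≡ vmap just v) × ¬ rel 𝔄 R v

  Every : MTeam (card 𝔄) N → (Asg (card 𝔄) N → Set) → Set
  Every m P = (s : Asg (card 𝔄) N) → 1 ≤ m s → P s

  listVals : Asg (card 𝔄) N → List (Fin N) → List (Maybe A)
  listVals s = map (lookup s)

  Sat : Formula τ N → MTeam (card 𝔄) N → Set
  Sat (x ≐ y)        m = Every m λ s → litEq s x y
  Sat (x ≠ y)        m = Every m λ s → litNeq s x y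
  Sat (rel⁺ R xs)    m = Every m λ s → litRel s R xs
  Sat (rel⁻ R xs)    m = Every m λ s → litNRel s R xs
  Sat (dep xs ys)    m = (s s′ : Asg (card 𝔄) N) → 1 ≤ m s → 1 ≤ m s′ →
                         listVals s xs ≡ listVals s′ xs →
                         listVals s ys ≡ listVals s′ ys
  Sat (φ ∧ ψ)        m = Sat φ m × Sat ψ m
  Sat (φ ∨ ψ)        m = Σ (MTeam (card 𝔄) N) λ k → Σ (MTeam (card 𝔄) N) λ l →
                         ((s : Asg (card 𝔄) N) → k s + l s ≡ m s) × Sat φ k × Sat ψ l
  Sat (∀′ x φ)       m = Sat φ (forallMod 𝔄 m x)
  Sat (∃′ x φ)       m = Σ ((s : Asg (card 𝔄) N) → Fin (m s) → A) λ F →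
                         ((s : Asg (card 𝔄) N) (i : Fin (m s)) → 1 ≤ mult 𝔄 (F s i)) ×
                         Sat φ (existsMod m x F)

flatten : ∀ {k N} → MTeam k N → MTeam k N
flatten m s with m s
... | zero  = 0
... | suc _ = 1

module Submission where

-- We prove something stronger: satisfaction is antitone in the SUPPORT of a
-- multiteam.  Writing  m′ ⊑ m  when every assignment of positive
-- multiplicity in m′ also has positive multiplicity in m, we show by
-- induction on φ that  m′ ⊑ m  and  Sat φ m  imply  Sat φ m′.
-- Literals and dependence atoms only look at the support.  A split of m
-- for ∨ transfers to m′ by routing all copies of s to the left part
-- whenever the left part of m contains s.  For ∀ and ∃ the modified
-- multiteams are both instances of one "collection" construction whose
-- support is described exactly (collect-support); for ∃ every copy of s
-- in m′ reuses the choice made for the first copy of s in m.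
-- Since m and flatten m have the same support, the theorem follows by
-- applying the antitonicity lemma in both directions.

open import Defs
open import Data.Nat using (ℕ; zero; suc; _+_; _*_; _≤_; z≤n; s≤s; >-nonZero⁻¹)
open import Data.Nat.Properties using (≤-trans; m≤m+n; m≤n+m; *-mono-≤; +-identityʳ)
open import Data.Fin using (Fin; fromℕ<)
open import Data.Fin.Properties using (nonZeroIndex)
open import Data.List using (List; []; _∷_; map; allFin)
open import Data.Nat.ListAction using (sum)
open import Data.List.Membership.Propositional using (_∈_)
open import Data.List.Membership.Propositional.Properties using (∈-allFin; ∈-map⁺; ∈-concatMap⁺)
open import Data.List.Relation.Unary.Any using (Any; here; there)
open import Data.Maybe using (just; nothing)
open import Data.Vec using (_[_]≔_) renaming ([] to v[]; _∷_ to _v∷_)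
open import Data.Product using (Σ; _×_; _,_)
open import Data.Sum using (_⊎_; inj₁; inj₂)
open import Relation.Nullary using (yes; no)
open import Relation.Binary.PropositionalEquality using (_≡_; refl; subst; sym)
open import Function.Bundles using (_⇔_; mk⇔)

+-positive : ∀ a b → 1 ≤ a + b → 1 ≤ a ⊎ 1 ≤ b
+-positive zero    b p = inj₂ p
+-positive (suc a) b p = inj₁ (s≤s z≤n)

*-positive : ∀ a b → 1 ≤ a * b → 1 ≤ a × 1 ≤ b
*-positive (suc a) (suc b) p = s≤s z≤n , s≤s z≤n
*-positive (suc a) zero    p with *-positive a zero p
... | _ , ()
*-positive zero    b       ()

sum-positive⇒summand : ∀ {A : Set} (f : A → ℕ) (xs : List A) →
                       1 ≤ sum (map f xs) → Σ A λ x → 1 ≤ f x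
sum-positive⇒summand f []       ()
sum-positive⇒summand f (x ∷ xs) p with +-positive (f x) (sum (map f xs)) p
... | inj₁ q = x , q
... | inj₂ q = sum-positive⇒summand f xs q

summand⇒sum-positive : ∀ {A : Set} (f : A → ℕ) {xs : List A} {x : A} →
                       x ∈ xs → 1 ≤ f x → 1 ≤ sum (map f xs)
summand⇒sum-positive f {y ∷ _} (here refl) p = ≤-trans p (m≤m+n (f y) _)
summand⇒sum-positive f {y ∷ _} (there x∈) p =
  ≤-trans (summand⇒sum-positive f x∈ p) (m≤n+m _ (f y))

Fin⇒positive : ∀ {n} → Fin n → 1 ≤ n
Fin⇒positive {n} i = >-nonZero⁻¹ n {{nonZeroIndex i}}

indicator-positive⇒ : ∀ {k N} (u t : Asg k N) (c : ℕ) →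
                      1 ≤ [ u ≡? t ]· c → u ≡ t × 1 ≤ c
indicator-positive⇒ u t c p with u ≟A t
... | yes u≡t = u≡t , p
indicator-positive⇒ u t c () | no _

indicator-positive⇐ : ∀ {k N} (u t : Asg k N) (c : ℕ) →
                      u ≡ t → 1 ≤ c → 1 ≤ [ u ≡? t ]· c
indicator-positive⇐ u t c u≡t p with u ≟A t
... | yes _  = p
... | no u≢t with u≢t u≡t
...   | ()

allAsg-complete : ∀ k N (s : Asg k N) → s ∈ allAsg k N
allAsg-complete k zero    v[]      = here refl
allAsg-complete k (suc N) (o v∷ w) =
  ∈-concatMap⁺ (λ o′ → map (o′ v∷_) (allAsg k N)) (first-entry o refl)
  where
  Contains : _ → Set
  Contains o′ = (o v∷ w) ∈ map (o′ v∷_) (allAsg k N)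

  tail-listed : Contains o
  tail-listed = ∈-map⁺ (o v∷_) (allAsg-complete k N w)

  among-values : ∀ a (as : List (Fin k)) → a ∈ as → o ≡ just a → Any Contains (map just as)
  among-values a (.a ∷ as) (here refl) refl = here tail-listed
  among-values a (_  ∷ as) (there a∈)  eq   = there (among-values a as a∈ eq)

  first-entry : ∀ o′ → o ≡ o′ → Any Contains (nothing ∷ map just (allFin k))
  first-entry nothing  refl = here tail-listed
  first-entry (just a) eq   = there (among-values a (allFin k) (∈-allFin a) eq)

_⊑_ : ∀ {X : Set} → (X → ℕ) → (X → ℕ) → Set
m′ ⊑ m = ∀ s → 1 ≤ m′ s → 1 ≤ m s

-- A decomposition m = k + l lifts to any m′ ⊑ m: give all of m′ s to the
-- left part if k s is positive and to the right part otherwise.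

split-lifts : ∀ {X : Set} (k l m m′ : X → ℕ) → (∀ s → k s + l s ≡ m s) → m′ ⊑ m →
              Σ (X → ℕ) λ k′ → Σ (X → ℕ) λ l′ →
                (∀ s → k′ s + l′ s ≡ m′ s) × k′ ⊑ k × l′ ⊑ l
split-lifts k l m m′ k+l≡m m′⊑m =
  (λ s → left (k s) (m′ s)) , (λ s → right (k s) (m′ s)) ,
  (λ s → left+right (k s) (m′ s)) ,
  (λ s → left⊑ (k s) (m′ s)) ,
  (λ s → right⊑ (k s) (l s) (m′ s) (m s) (k+l≡m s) (m′⊑m s))
  where
  left right : ℕ → ℕ → ℕ
  left  zero    c = 0
  left  (suc _) c = c
  right zero    c = c
  right (suc _) c = 0

  left+right : ∀ a c → left a c + right a c ≡ c
  left+right zero    c = refl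
  left+right (suc a) c = +-identityʳ c

  left⊑ : ∀ a c → 1 ≤ left a c → 1 ≤ a
  left⊑ (suc a) c _ = s≤s z≤n
  left⊑ zero    c ()

  right⊑ : ∀ a b c d → a + b ≡ d → (1 ≤ c → 1 ≤ d) → 1 ≤ right a c → 1 ≤ b
  right⊑ zero    b c d b≡d c⊑d p = subst (1 ≤_) (sym b≡d) (c⊑d p)
  right⊑ (suc a) b c d _   _   ()

-- Both (X,m)[(A,n)/x] and
-- (X,m)[F/x] are of this form (definitionally).

collect : ∀ {k N} (J : Asg k N → ℕ) (u : ∀ s → Fin (J s) → Asg k N)
          (c : ∀ s → Fin (J s) → ℕ) → MTeam k N
collect {k} {N} J u c t =
  sum (map (λ s → sum (map (λ j → [ u s j ≡? t ]· c s j) (allFin (J s)))) (allAsg k N))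

collect-support⇒ : ∀ {k N} J u c (t : Asg k N) → 1 ≤ collect J u c t →
                   Σ (Asg k N) λ s → Σ (Fin (J s)) λ j → u s j ≡ t × 1 ≤ c s j
collect-support⇒ {k} {N} J u c t p with sum-positive⇒summand _ (allAsg k N) p
... | s , q with sum-positive⇒summand _ (allFin (J s)) q
...   | j , r = s , j , indicator-positive⇒ (u s j) t (c s j) r

collect-support⇐ : ∀ {k N} J u c (t : Asg k N) (s : Asg k N) (j : Fin (J s)) →
                   u s j ≡ t → 1 ≤ c s j → 1 ≤ collect J u c t
collect-support⇐ {k} {N} J u c t s j u≡t p =
  summand⇒sum-positive _ (allAsg-complete k N s)
    (summand⇒sum-positive _ (∈-allFin j) (indicator-positive⇐ (u s j) t (c s j) u≡t p))

module _ {τ : Signature} {N : ℕ} (𝔄 : MultiStructure τ) where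

  private
    A  = Fin (card 𝔄)
    MT = MTeam (card 𝔄) N

  forallMod-⊑ : ∀ (m m′ : MT) x → m′ ⊑ m → forallMod 𝔄 m′ x ⊑ forallMod 𝔄 m x
  forallMod-⊑ m m′ x m′⊑m t p
    with collect-support⇒ (λ _ → card 𝔄) (λ s a → s [ x ]≔ just a) (λ s a → m′ s * mult 𝔄 a) t p
  ... | s , a , eq , q with *-positive (m′ s) (mult 𝔄 a) q
  ...   | m′s>0 , a>0 =
    collect-support⇐ (λ _ → card 𝔄) (λ s a → s [ x ]≔ just a) (λ s a → m s * mult 𝔄 a)
                     t s a eq (*-mono-≤ (m′⊑m s m′s>0) a>0)

  -- Every copy of s in m′ reuses the choice for the first copy of s in m.

  reuseChoice : ∀ (m m′ : MT) → m′ ⊑ m → (∀ s → Fin (m s) → A) → ∀ s → Fin (m′ s) → A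
  reuseChoice m m′ m′⊑m F s i = F s (fromℕ< (m′⊑m s (Fin⇒positive i)))

  existsMod-⊑ : ∀ (m m′ : MT) x (m′⊑m : m′ ⊑ m) F →
                existsMod m′ x (reuseChoice m m′ m′⊑m F) ⊑ existsMod m x F
  existsMod-⊑ m m′ x m′⊑m F t p
    with collect-support⇒ m′ (λ s i → s [ x ]≔ just (reuseChoice m m′ m′⊑m F s i)) (λ _ _ → 1) t p
  ... | s , i , eq , _ =
    collect-support⇐ m (λ s j → s [ x ]≔ just (F s j)) (λ _ _ → 1)
                     t s (fromℕ< (m′⊑m s (Fin⇒positive i))) eq (s≤s z≤n)

  Sat-antitone : ∀ (φ : Formula τ N) (m m′ : MT) → m′ ⊑ m → Sat 𝔄 φ m → Sat 𝔄 φ m′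
  Sat-antitone (x ≐ y)     m m′ m′⊑m sat s p = sat s (m′⊑m s p)
  Sat-antitone (x ≠ y)     m m′ m′⊑m sat s p = sat s (m′⊑m s p)
  Sat-antitone (rel⁺ R xs) m m′ m′⊑m sat s p = sat s (m′⊑m s p)
  Sat-antitone (rel⁻ R xs) m m′ m′⊑m sat s p = sat s (m′⊑m s p)
  Sat-antitone (dep xs ys) m m′ m′⊑m sat s s′ p p′ = sat s s′ (m′⊑m s p) (m′⊑m s′ p′)
  Sat-antitone (φ ∧ ψ)     m m′ m′⊑m (satφ , satψ) =
    Sat-antitone φ m m′ m′⊑m satφ , Sat-antitone ψ m m′ m′⊑m satψ
  Sat-antitone (φ ∨ ψ)     m m′ m′⊑m (k , l , k+l≡m , satφ , satψ)
    with split-lifts k l m m′ k+l≡m m′⊑m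
  ... | k′ , l′ , k′+l′≡m′ , k′⊑k , l′⊑l =
    k′ , l′ , k′+l′≡m′ , Sat-antitone φ k k′ k′⊑k satφ , Sat-antitone ψ l l′ l′⊑l satψ
  Sat-antitone (∀′ x φ)    m m′ m′⊑m sat =
    Sat-antitone φ _ _ (forallMod-⊑ m m′ x m′⊑m) sat
  Sat-antitone (∃′ x φ)    m m′ m′⊑m (F , F-ok , sat) =
    reuseChoice m m′ m′⊑m F ,
    (λ s i → F-ok s _) ,
    Sat-antitone φ _ _ (existsMod-⊑ m m′ x m′⊑m F) sat

flatten-⊑ : ∀ {k N} (m : MTeam k N) → flatten m ⊑ m
flatten-⊑ m s p with m s
... | suc _ = s≤s z≤n
flatten-⊑ m s () | zero

⊑-flatten : ∀ {k N} (m : MTeam k N) → m ⊑ flatten m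
⊑-flatten m s p with m s
... | suc _ = s≤s z≤n
⊑-flatten m s () | zero

proposition8 : (τ : Signature) (N : ℕ) (𝔄 : MultiStructure τ) (φ : Formula τ N)
               (m : MTeam (card 𝔄) N) → IsMultiteam m →
               Sat 𝔄 φ m ⇔ Sat 𝔄 φ (flatten m)
proposition8 τ N 𝔄 φ m _ =
  mk⇔ (Sat-antitone 𝔄 φ m (flatten m) (flatten-⊑ m))
      (Sat-antitone 𝔄 φ (flatten m) m (⊑-flatten m))
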